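{- Let $k$ be a positive integer, let $p_1,\ldots,p_k$ be distinct primes each congruent to $1$ modulo $4$, let $n_1,\ldots,n_k$ be positive integers, let $\epsilon_1,\ldots,\epsilon_k \in \{\pm 1\}$, and let $(a,b,c) = \operatorname{pt}\bigl(\zeta_{p_1}^{\epsilon_1 n_1}\cdots \zeta_{p_k}^{\epsilon_k n_k}\bigr)$. Then $c = p_1^{n_1}\cdots p_k^{n_k}$.
   Context: A pythagorean triple is a triple $(a,b,c)$ of positive integers with $a^2+b^2=c^2$; it is normalized if $\gcd(a,b,c)=1$ and $a\le b$. Let $G(\mathbb{Q}) = \{ s + t\,i \in \mathbb{C} \mid s,t\in\mathbb{Q},\ s^2+t^2=1\}$ (a group under multiplication) and $U = \{\pm1,\pm i\}$. For $\zeta = s+t\,i \in G(\mathbb{Q})\setminus U$, $\operatorname{pt}(\zeta)$ denotes the unique normalized pythagorean triple $(a,b,c)$ with $a/c = \min(|s|,|t|)$ and $b/c = \max(|s|,|t|)$ (equivalently, the normalized triple encoded by the point of the orbit of $\zeta$ under $\zeta\mapsto i\zeta$, $\zeta\mapsto\bar\zeta$ lying in the octant $0<s<t$). For a prime $p\equiv 1 \pmod 4$, write $p=m^2+n^2$ with integers $0<m<n$ (these are unique), set $q=m+n\,i$, $\bar q = m-n\,i$, and $\zeta_p = q/\bar q \in G(\mathbb{Q})$. -}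

module Defs where

open import Data.Nat as ℕ using (ℕ; zero; suc)
open import Data.Nat.GCD using (gcd)
open import Data.Integer as ℤ using (ℤ; +_; -[1+_]; _◃_)
open import Data.Sign using (Sign)
open import Data.Fin using (Fin; zero; suc)
open import Data.Rational as ℚ using (ℚ; 0ℚ; 1ℚ; _≟_; ≢-nonZero)
open import Data.Product using (_×_)
open import Relation.Nullary using (yes; no)
open import Relation.Binary.PropositionalEquality using (_≡_)

record GQ : Set where
  constructor _+i_
  field
    re : ℚ
    im : ℚ
open GQ public

oneG : GQ
oneG = 1ℚ +i 0ℚ

infixl 7 _*G_
_*G_ : GQ → GQ → GQ
(a +i b) *G (c +i d) = (a ℚ.* c ℚ.- b ℚ.* d) +i (a ℚ.* d ℚ.+ b ℚ.* c)

conjG : GQ → GQ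
conjG (a +i b) = a +i (ℚ.- b)

normG : GQ → ℚ
normG (a +i b) = a ℚ.* a ℚ.+ b ℚ.* b

-- multiplicative inverse z⁻¹ = z̄ / |z|²  (junk value 0 at z = 0)
invG : GQ → GQ
invG z with normG z ≟ 0ℚ
... | yes _ = 0ℚ +i 0ℚ
... | no ne = (re (conjG z) ℚ.* r) +i (im (conjG z) ℚ.* r)
  where
    r : ℚ
    r = ℚ.1/_ (normG z) {{≢-nonZero ne}}

_/G_ : GQ → GQ → GQ
z /G w = z *G invG w

_^G_ : GQ → ℕ → GQ
z ^G zero = oneG
z ^G suc n = z *G (z ^G n)

_^ℤ_ : GQ → ℤ → GQ
z ^ℤ (+ n) = z ^G n
z ^ℤ -[1+ n ] = invG z ^G suc n

ofℕ : ℕ → ℚ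
ofℕ m = + m ℚ./ 1

-- ζ_p = q / q̄ with q = m + n i, where p = m² + n², 0 < m < n
zetaP : ℕ → ℕ → GQ
zetaP m n = q /G conjG q
  where
    q : GQ
    q = ofℕ m +i ofℕ n

prodG : (k : ℕ) → (Fin k → GQ) → GQ
prodG zero f = oneG
prodG (suc k) f = f zero *G prodG k (λ i → f (suc i))

prodℕ : (k : ℕ) → (Fin k → ℕ) → ℕ
prodℕ zero f = 1
prodℕ (suc k) f = f zero ℕ.* prodℕ k (λ i → f (suc i))

-- a / c as a rational (c > 0 is required wherever this is used)
frac : ℕ → ℕ → ℚ
frac a zero = 0ℚ
frac a (suc c) = + a ℚ./ suc c

NormalizedPT : ℕ → ℕ → ℕ → Set
NormalizedPT a b c =
  (0 ℕ.< a) × (0 ℕ.< b) × (0 ℕ.< c) ×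
  (a ℕ.* a ℕ.+ b ℕ.* b ≡ c ℕ.* c) ×
  (gcd (gcd a b) c ≡ 1) × (a ℕ.≤ b)

IsPt : GQ → ℕ → ℕ → ℕ → Set
IsPt (s +i t) a b c =
  NormalizedPT a b c ×
  (frac a c ≡ ℚ.∣ s ∣ ℚ.⊓ ℚ.∣ t ∣) ×
  (frac b c ≡ ℚ.∣ s ∣ ℚ.⊔ ℚ.∣ t ∣)

-- ζ_p = q / q̄ = q² / p and ζ_p⁻¹ = q̄² / p = (−m + n i)² / p, so the product ζ equals W / N with
-- W = ∏ (±m_i + n_i i)^(2 e_i) ∈ ℤ[i] and N = ∏ p_i^(e_i), where N(W) = N². For each j, the
-- Gaussian integers x + y i with n_j x ± m_j y ≢ 0 (mod p_j) are those outside a prime 𝔭_j of ℤ[i]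
-- above p_j. They form a multiplicative set containing ±m_j + n_j i (as p_j ≠ 2) and every other
-- factor (whose norm p_i is prime to p_j), so W ∉ 𝔭_j. As p_j divides X² + Y² = N(W), it then
-- divides neither X nor Y. Hence X / N and Y / N are reduced fractions, and the hypotenuse of the
-- normalized triple is N.
module Submission where

open import Defs
open import Level using (0ℓ)
open import Algebra.Bundles using (CommutativeRing)
open import Data.Nat using (ℕ; zero; suc; _<_; _+_; _*_; _^_; _%_; z≤n; s≤s; >-nonZero)
import Data.Nat.Properties as ℕP
open import Data.Integer as ℤ using (ℤ; +_; _◃_)
import Data.Integer.Properties as ℤP
import Data.Integer.Tactic.RingSolver as ℤSolver
open import Data.Rational as ℚ using (ℚ; 0ℚ; 1ℚ)
import Data.Rational.Properties as ℚP
open import Data.Rational.Unnormalised using (mkℚᵘ; *≡*) renaming (_≃_ to _≃ᵘ_)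
import Data.Rational.Unnormalised.Properties as ℚᵘP
open import Data.Integer.Divisibility.Signed as ℤD using () renaming (_∣_ to _∣ℤ_)
open import Data.Nat.Divisibility using (_∣_; divides; quotient; m∣n⇒n≡quotient*m; >⇒∤; ∣-trans; ∣1⇒≡1; ∣n⇒∣m*n; m∣m*n)
open import Data.Nat.Coprimality using (Coprime; coprime-divisor)
open import Data.Nat.GCD using (gcd; gcd-greatest)
open import Data.Nat.Primality using (Prime; euclidsLemma; prime⇒irreducible; ¬prime[0]; ¬prime[1])
open import Data.Sum using (_⊎_; inj₁; inj₂; [_,_])
import Data.Sum as Sum
open import Data.Sign as Sign using (Sign)
import Data.Sign.Properties as SignP
open import Data.Fin as Fin using (Fin; zero; suc)
open import Function.Definitions using (Injective)
open import Data.Product using (Σ; _×_; _,_; proj₁; proj₂)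
open import Data.Maybe using (nothing)
open import Function using (_∘_; case_of_)
open import Data.Empty using (⊥-elim)
open import Relation.Nullary using (¬_; yes; no)
open import Relation.Binary.PropositionalEquality using (_≡_; _≢_; refl; sym; trans; cong; cong₂; subst; module ≡-Reasoning)
import Algebra.Properties.CommutativeSemigroup ℤP.*-commutativeSemigroup as ℤ*
import Algebra.Properties.CommutativeSemigroup (CommutativeRing.*-commutativeSemigroup ℚP.+-*-commutativeRing) as ℚ*
open import Tactic.RingSolver using (solve-∀)
open import Tactic.RingSolver.Core.AlmostCommutativeRing using (AlmostCommutativeRing; fromCommutativeRing)

ℚ-ring : AlmostCommutativeRing 0ℓ 0ℓ
ℚ-ring = fromCommutativeRing ℚP.+-*-commutativeRing (λ _ → nothing)

-- ofℕ m from Defs is ι (+ m) by definition.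
ι : ℤ → ℚ
ι x = x ℚ./ 1

private
  toℚᵘ-/ : ∀ x d → ℚ.toℚᵘ (x ℚ./ suc d) ≃ᵘ mkℚᵘ x d
  toℚᵘ-/ x d = ℚP.toℚᵘ-fromℚᵘ (mkℚᵘ x d)

  ≡-via-ℚᵘ : ∀ {p q u v} → ℚ.toℚᵘ p ≃ᵘ u → ℚ.toℚᵘ q ≃ᵘ v → u ≃ᵘ v → p ≡ q
  ≡-via-ℚᵘ p≃u q≃v u≃v = ℚP.toℚᵘ-injective (ℚᵘP.≃-trans p≃u (ℚᵘP.≃-trans u≃v (ℚᵘP.≃-sym q≃v)))

ι-+ : ∀ x y → ι (x ℤ.+ y) ≡ ι x ℚ.+ ι y
ι-+ x y = ≡-via-ℚᵘ (toℚᵘ-/ (x ℤ.+ y) 0)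
  (ℚᵘP.≃-trans (ℚP.toℚᵘ-homo-+ (ι x) (ι y)) (ℚᵘP.+-cong (toℚᵘ-/ x 0) (toℚᵘ-/ y 0)))
  (*≡* (identity x y))
  where
  identity : ∀ x y → (x ℤ.+ y) ℤ.* + 1 ≡ (x ℤ.* + 1 ℤ.+ y ℤ.* + 1) ℤ.* + 1
  identity = ℤSolver.solve-∀

ι-* : ∀ x y → ι (x ℤ.* y) ≡ ι x ℚ.* ι y
ι-* x y = ≡-via-ℚᵘ (toℚᵘ-/ (x ℤ.* y) 0)
  (ℚᵘP.≃-trans (ℚP.toℚᵘ-homo-* (ι x) (ι y)) (ℚᵘP.*-cong (toℚᵘ-/ x 0) (toℚᵘ-/ y 0)))
  (*≡* refl)

ι-neg : ∀ x → ι (ℤ.- x) ≡ ℚ.- ι x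
ι-neg x = ≡-via-ℚᵘ (toℚᵘ-/ (ℤ.- x) 0)
  (ℚᵘP.≃-trans (ℚP.toℚᵘ-homo‿- (ι x)) (ℚᵘP.-‿cong (toℚᵘ-/ x 0)))
  (*≡* refl)

ι-- : ∀ x y → ι (x ℤ.- y) ≡ ι x ℚ.- ι y
ι-- x y = trans (ι-+ x (ℤ.- y)) (cong (ι x ℚ.+_) (ι-neg y))

ι-injective : ∀ {x y} → ι x ≡ ι y → x ≡ y
ι-injective {x} {y} eq with ℚᵘP.≃-trans (ℚᵘP.≃-sym (toℚᵘ-/ x 0)) (ℚᵘP.≃-trans (ℚP.toℚᵘ-cong eq) (toℚᵘ-/ y 0))
... | *≡* x*1≡y*1 = trans (sym (ℤP.*-identityʳ x)) (trans x*1≡y*1 (ℤP.*-identityʳ y))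

∣ι∣ : ∀ x → ℚ.∣ ι x ∣ ≡ ι (+ ℤ.∣ x ∣)
∣ι∣ x = ≡-via-ℚᵘ (ℚᵘP.≃-trans (ℚP.toℚᵘ-homo-∣-∣ (ι x)) (ℚᵘP.∣-∣-cong (toℚᵘ-/ x 0))) (toℚᵘ-/ _ 0) ℚᵘP.≃-refl

/-*-denominator : ∀ x d → (x ℚ./ suc d) ℚ.* ι (+ suc d) ≡ ι x
/-*-denominator x d = ≡-via-ℚᵘ
  (ℚᵘP.≃-trans (ℚP.toℚᵘ-homo-* (x ℚ./ suc d) (ι (+ suc d))) (ℚᵘP.*-cong (toℚᵘ-/ x d) (toℚᵘ-/ (+ suc d) 0)))
  (toℚᵘ-/ x 0) (*≡* (identity x (+ suc d)))
  where
  identity : ∀ x y → (x ℤ.* y) ℤ.* + 1 ≡ x ℤ.* (y ℤ.* + 1)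
  identity = ℤSolver.solve-∀

ι-inverse : ∀ d → ι (+ suc d) ℚ.* (+ 1 ℚ./ suc d) ≡ 1ℚ
ι-inverse d = trans (ℚP.*-comm (ι (+ suc d)) (+ 1 ℚ./ suc d)) (/-*-denominator (+ 1) d)

ι-pos-* : ∀ a b → ι (+ (a * b)) ≡ ι (+ a) ℚ.* ι (+ b)
ι-pos-* a b = trans (cong ι (ℤP.pos-* a b)) (ι-* (+ a) (+ b))

-- Gaussian integers

ℤ[i] : Set
ℤ[i] = ℤ × ℤ

1ᵢ : ℤ[i]
1ᵢ = + 1 , + 0

infixl 7 _·ᵢ_
_·ᵢ_ : ℤ[i] → ℤ[i] → ℤ[i]
(x , y) ·ᵢ (x' , y') = x ℤ.* x' ℤ.- y ℤ.* y' , x ℤ.* y' ℤ.+ y ℤ.* x'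

conjᵢ : ℤ[i] → ℤ[i]
conjᵢ (x , y) = x , ℤ.- y

normᵢ : ℤ[i] → ℤ
normᵢ (x , y) = x ℤ.* x ℤ.+ y ℤ.* y

infixr 8 _^ᵢ_
_^ᵢ_ : ℤ[i] → ℕ → ℤ[i]
w ^ᵢ zero = 1ᵢ
w ^ᵢ suc e = w ·ᵢ w ^ᵢ e

prodᵢ : (k : ℕ) → (Fin k → ℤ[i]) → ℤ[i]
prodᵢ zero w = 1ᵢ
prodᵢ (suc k) w = w zero ·ᵢ prodᵢ k (λ i → w (suc i))

normᵢ-· : ∀ u v → normᵢ (u ·ᵢ v) ≡ normᵢ u ℤ.* normᵢ v
normᵢ-· (x , y) (x' , y') = identity x y x' y'
  where
  identity : ∀ x y x' y' →
    (x ℤ.* x' ℤ.- y ℤ.* y') ℤ.* (x ℤ.* x' ℤ.- y ℤ.* y') ℤ.+ (x ℤ.* y' ℤ.+ y ℤ.* x') ℤ.* (x ℤ.* y' ℤ.+ y ℤ.* x')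
      ≡ (x ℤ.* x ℤ.+ y ℤ.* y) ℤ.* (x' ℤ.* x' ℤ.+ y' ℤ.* y')
  identity = ℤSolver.solve-∀

conjᵢ-involutive : ∀ w → conjᵢ (conjᵢ w) ≡ w
conjᵢ-involutive (x , y) = cong (x ,_) (ℤP.neg-involutive y)

normᵢ-conjᵢ : ∀ w → normᵢ (conjᵢ w) ≡ normᵢ w
normᵢ-conjᵢ (x , y) = identity x y
  where
  identity : ∀ x y → x ℤ.* x ℤ.+ ℤ.- y ℤ.* ℤ.- y ≡ x ℤ.* x ℤ.+ y ℤ.* y
  identity = ℤSolver.solve-∀

normᵢ-pos : ∀ m n → normᵢ (+ m , + n) ≡ + (m * m + n * n)
normᵢ-pos m n = trans (cong₂ ℤ._+_ (sym (ℤP.pos-* m m)) (sym (ℤP.pos-* n n))) (sym (ℤP.pos-+ (m * m) (n * n)))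

generator : Sign → ℕ → ℕ → ℤ[i]
generator ε m n = ε ◃ m , + n

normᵢ-generator : ∀ ε m n → normᵢ (generator ε m n) ≡ + (m * m + n * n)
normᵢ-generator ε m n = trans (cong (ℤ._+ + n ℤ.* + n) ◃-square) (normᵢ-pos m n)
  where
  ◃-square : (ε ◃ m) ℤ.* (ε ◃ m) ≡ + m ℤ.* + m
  ◃-square = begin
    (ε ◃ m) ℤ.* (ε ◃ m)      ≡⟨ sym (ℤP.◃-distrib-* ε ε m m) ⟩
    (ε Sign.* ε) ◃ (m * m)  ≡⟨ cong (_◃ (m * m)) (SignP.s*s≡+ ε) ⟩
    Sign.+ ◃ (m * m)        ≡⟨ ℤP.+◃n≡+n (m * m) ⟩
    + (m * m)               ≡⟨ ℤP.pos-* m m ⟩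
    + m ℤ.* + m             ∎
    where open ≡-Reasoning

conjᵢ-square : ∀ x y → conjᵢ ((x , y) ·ᵢ (x , y)) ≡ (ℤ.- x , y) ·ᵢ (ℤ.- x , y)
conjᵢ-square x y = cong₂ _,_ (real-part x y) (imaginary-part x y)
  where
  real-part : ∀ x y → x ℤ.* x ℤ.- y ℤ.* y ≡ ℤ.- x ℤ.* ℤ.- x ℤ.- y ℤ.* y
  real-part = ℤSolver.solve-∀
  imaginary-part : ∀ x y → ℤ.- (x ℤ.* y ℤ.+ y ℤ.* x) ≡ ℤ.- x ℤ.* y ℤ.+ y ℤ.* ℤ.- x
  imaginary-part = ℤSolver.solve-∀

scaled : ℤ[i] → ℚ → GQ
scaled (x , y) s = (ι x ℚ.* s) +i (ι y ℚ.* s)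

scaled-*G : ∀ w w' s s' → scaled w s *G scaled w' s' ≡ scaled (w ·ᵢ w') (s ℚ.* s')
scaled-*G (x , y) (x' , y') s s' = cong₂ _+i_
  (trans (real-part (ι x) (ι x') (ι y) (ι y') s s')
         (cong (ℚ._* (s ℚ.* s')) (sym (trans (ι-- (x ℤ.* x') (y ℤ.* y')) (cong₂ ℚ._-_ (ι-* x x') (ι-* y y'))))))
  (trans (imaginary-part (ι x) (ι y') (ι y) (ι x') s s')
         (cong (ℚ._* (s ℚ.* s')) (sym (trans (ι-+ (x ℤ.* y') (y ℤ.* x')) (cong₂ ℚ._+_ (ι-* x y') (ι-* y x'))))))
  where
  real-part : ∀ a b c d u v → (a ℚ.* u) ℚ.* (b ℚ.* v) ℚ.- (c ℚ.* u) ℚ.* (d ℚ.* v) ≡ (a ℚ.* b ℚ.- c ℚ.* d) ℚ.* (u ℚ.* v)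
  real-part = solve-∀ ℚ-ring
  imaginary-part : ∀ a b c d u v → (a ℚ.* u) ℚ.* (b ℚ.* v) ℚ.+ (c ℚ.* u) ℚ.* (d ℚ.* v) ≡ (a ℚ.* b ℚ.+ c ℚ.* d) ℚ.* (u ℚ.* v)
  imaginary-part = solve-∀ ℚ-ring

normG-scaled : ∀ w s → normG (scaled w s) ≡ ι (normᵢ w) ℚ.* (s ℚ.* s)
normG-scaled (x , y) s = trans (identity (ι x) (ι y) s)
  (cong (ℚ._* (s ℚ.* s)) (sym (trans (ι-+ (x ℤ.* x) (y ℤ.* y)) (cong₂ ℚ._+_ (ι-* x x) (ι-* y y)))))
  where
  identity : ∀ a b s → (a ℚ.* s) ℚ.* (a ℚ.* s) ℚ.+ (b ℚ.* s) ℚ.* (b ℚ.* s) ≡ (a ℚ.* a ℚ.+ b ℚ.* b) ℚ.* (s ℚ.* s)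
  identity = solve-∀ ℚ-ring

scaled-1ℚ : ∀ x y → scaled (x , y) 1ℚ ≡ ι x +i ι y
scaled-1ℚ x y = cong₂ _+i_ (ℚP.*-identityʳ (ι x)) (ℚP.*-identityʳ (ι y))

conjG-scaled : ∀ w s → conjG (scaled w s) ≡ scaled (conjᵢ w) s
conjG-scaled (x , y) s = cong ((ι x ℚ.* s) +i_) (trans (ℚP.neg-distribˡ-* (ι y) s) (cong (ℚ._* s) (sym (ι-neg y))))

invG-unique : ∀ z r → normG z ℚ.* r ≡ 1ℚ → invG z ≡ (re (conjG z) ℚ.* r) +i (im (conjG z) ℚ.* r)
invG-unique z r |z|²r≡1 with normG z ℚ.≟ 0ℚ
... | yes |z|²≡0 = ⊥-elim (ℚP.1≢0 (trans (sym |z|²r≡1) (trans (cong (ℚ._* r) |z|²≡0) (ℚP.*-zeroˡ r))))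
... | no |z|²≢0 = cong₂ _+i_ (cong (re (conjG z) ℚ.*_) |z|⁻²≡r) (cong (im (conjG z) ℚ.*_) |z|⁻²≡r)
  where
  instance _ = ℚ.≢-nonZero |z|²≢0
  open ≡-Reasoning
  |z|⁻²≡r : ℚ.1/ normG z ≡ r
  |z|⁻²≡r = begin
    ℚ.1/ normG z                        ≡⟨ sym (ℚP.*-identityʳ (ℚ.1/ normG z)) ⟩
    ℚ.1/ normG z ℚ.* 1ℚ                 ≡⟨ cong (ℚ.1/ normG z ℚ.*_) (sym |z|²r≡1) ⟩
    ℚ.1/ normG z ℚ.* (normG z ℚ.* r)    ≡⟨ sym (ℚP.*-assoc (ℚ.1/ normG z) (normG z) r) ⟩
    (ℚ.1/ normG z ℚ.* normG z) ℚ.* r    ≡⟨ cong (ℚ._* r) (ℚP.*-inverseˡ (normG z)) ⟩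
    1ℚ ℚ.* r                            ≡⟨ ℚP.*-identityˡ r ⟩
    r                                   ∎

invG-scaled : ∀ w s r → normG (scaled w s) ℚ.* r ≡ 1ℚ → invG (scaled w s) ≡ scaled (conjᵢ w) (s ℚ.* r)
invG-scaled (x , y) s r |z|²r≡1 = trans (invG-unique (scaled (x , y) s) r |z|²r≡1)
  (cong₂ _+i_ (ℚP.*-assoc (ι x) s r)
    (trans (cong (ℚ._* r) (ℚP.neg-distribˡ-* (ι y) s))
      (trans (ℚP.*-assoc (ℚ.- ι y) s r) (cong (ℚ._* (s ℚ.* r)) (sym (ι-neg y))))))

-- Points of the unit circle with a given denominator

-- z = w / D; the condition N(w) = D² puts z on the unit circle.
infix 4 _≡_÷_
record _≡_÷_ (z : GQ) (w : ℤ[i]) (D : ℕ) : Set where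
  field
    D⁻¹ : ℚ
    D*D⁻¹≡1 : ι (+ D) ℚ.* D⁻¹ ≡ 1ℚ
    normᵢ≡D² : normᵢ w ≡ + D ℤ.* + D
    z≡w*D⁻¹ : z ≡ scaled w D⁻¹

1≡1ᵢ÷1 : oneG ≡ 1ᵢ ÷ 1
1≡1ᵢ÷1 = record { D⁻¹ = 1ℚ ; D*D⁻¹≡1 = refl ; normᵢ≡D² = refl ; z≡w*D⁻¹ = refl }

÷-*G : ∀ {z z' w w' D D'} → z ≡ w ÷ D → z' ≡ w' ÷ D' → z *G z' ≡ w ·ᵢ w' ÷ D * D'
÷-*G {w = w} {w'} {D} {D'} z÷ z'÷ = record
  { D⁻¹ = s ℚ.* s'
  ; D*D⁻¹≡1 = begin
      ι (+ (D * D')) ℚ.* (s ℚ.* s')         ≡⟨ cong (ℚ._* (s ℚ.* s')) (ι-pos-* D D') ⟩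
      (ι (+ D) ℚ.* ι (+ D')) ℚ.* (s ℚ.* s') ≡⟨ ℚ*.interchange (ι (+ D)) (ι (+ D')) s s' ⟩
      (ι (+ D) ℚ.* s) ℚ.* (ι (+ D') ℚ.* s') ≡⟨ cong₂ ℚ._*_ (D*D⁻¹≡1 z÷) (D*D⁻¹≡1 z'÷) ⟩
      1ℚ                                    ∎
  ; normᵢ≡D² = begin
      normᵢ (w ·ᵢ w')                         ≡⟨ normᵢ-· w w' ⟩
      normᵢ w ℤ.* normᵢ w'                    ≡⟨ cong₂ ℤ._*_ (normᵢ≡D² z÷) (normᵢ≡D² z'÷) ⟩
      (+ D ℤ.* + D) ℤ.* (+ D' ℤ.* + D')       ≡⟨ ℤ*.interchange (+ D) (+ D) (+ D') (+ D') ⟩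
      (+ D ℤ.* + D') ℤ.* (+ D ℤ.* + D')       ≡⟨ sym (cong₂ ℤ._*_ (ℤP.pos-* D D') (ℤP.pos-* D D')) ⟩
      + (D * D') ℤ.* + (D * D')               ∎
  ; z≡w*D⁻¹ = trans (cong₂ _*G_ (z≡w*D⁻¹ z÷) (z≡w*D⁻¹ z'÷)) (scaled-*G w w' s s')
  }
  where
  open _≡_÷_
  open ≡-Reasoning
  s = D⁻¹ z÷
  s' = D⁻¹ z'÷

÷-^G : ∀ {z w D} e → z ≡ w ÷ D → z ^G e ≡ w ^ᵢ e ÷ D ^ e
÷-^G zero z÷ = 1≡1ᵢ÷1
÷-^G (suc e) z÷ = ÷-*G z÷ (÷-^G e z÷)

÷-prodG : ∀ k {f w D} → (∀ i → f i ≡ w i ÷ D i) → prodG k f ≡ prodᵢ k w ÷ prodℕ k D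
÷-prodG zero f÷ = 1≡1ᵢ÷1
÷-prodG (suc k) f÷ = ÷-*G (f÷ zero) (÷-prodG k (λ i → f÷ (suc i)))

÷-invG : ∀ {z w D} → z ≡ w ÷ D → invG z ≡ conjᵢ w ÷ D
÷-invG {z} {w} {D} z÷ = record
  { D⁻¹ = s
  ; D*D⁻¹≡1 = D*D⁻¹≡1 z÷
  ; normᵢ≡D² = trans (normᵢ-conjᵢ w) (normᵢ≡D² z÷)
  ; z≡w*D⁻¹ = begin
      invG z                       ≡⟨ cong invG (z≡w*D⁻¹ z÷) ⟩
      invG (scaled w s)            ≡⟨ invG-scaled w s 1ℚ |z|²≡1 ⟩
      scaled (conjᵢ w) (s ℚ.* 1ℚ)  ≡⟨ cong (scaled (conjᵢ w)) (ℚP.*-identityʳ s) ⟩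
      scaled (conjᵢ w) s           ∎
  }
  where
  open _≡_÷_
  open ≡-Reasoning
  s = D⁻¹ z÷
  |z|²≡1 : normG (scaled w s) ℚ.* 1ℚ ≡ 1ℚ
  |z|²≡1 = begin
    normG (scaled w s) ℚ.* 1ℚ              ≡⟨ ℚP.*-identityʳ _ ⟩
    normG (scaled w s)                     ≡⟨ normG-scaled w s ⟩
    ι (normᵢ w) ℚ.* (s ℚ.* s)              ≡⟨ cong (λ x → ι x ℚ.* (s ℚ.* s)) (normᵢ≡D² z÷) ⟩
    ι (+ D ℤ.* + D) ℚ.* (s ℚ.* s)          ≡⟨ cong (ℚ._* (s ℚ.* s)) (ι-* (+ D) (+ D)) ⟩
    (ι (+ D) ℚ.* ι (+ D)) ℚ.* (s ℚ.* s)    ≡⟨ ℚ*.interchange (ι (+ D)) (ι (+ D)) s s ⟩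
    (ι (+ D) ℚ.* s) ℚ.* (ι (+ D) ℚ.* s)    ≡⟨ cong₂ ℚ._*_ (D*D⁻¹≡1 z÷) (D*D⁻¹≡1 z÷) ⟩
    1ℚ                                     ∎

zetaP-÷ : ∀ m n {P} → m * m + n * n ≡ P → 0 < P → zetaP m n ≡ (+ m , + n) ·ᵢ (+ m , + n) ÷ P
zetaP-÷ m n {suc d} m²+n²≡P _ = record
  { D⁻¹ = s
  ; D*D⁻¹≡1 = ι-inverse d
  ; normᵢ≡D² = trans (normᵢ-· q q) (cong₂ ℤ._*_ normᵢq normᵢq)
  ; z≡w*D⁻¹ = begin
      zetaP m n                                          ≡⟨ cong (λ u → u *G invG (conjG u)) (sym (scaled-1ℚ (+ m) (+ n))) ⟩
      scaled q 1ℚ *G invG (conjG (scaled q 1ℚ))          ≡⟨ cong (λ u → scaled q 1ℚ *G invG u) (conjG-scaled q 1ℚ) ⟩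
      scaled q 1ℚ *G invG (scaled (conjᵢ q) 1ℚ)          ≡⟨ cong (scaled q 1ℚ *G_) (invG-scaled (conjᵢ q) 1ℚ s |q̄|²s≡1) ⟩
      scaled q 1ℚ *G scaled (conjᵢ (conjᵢ q)) (1ℚ ℚ.* s) ≡⟨ cong (λ w → scaled q 1ℚ *G scaled w (1ℚ ℚ.* s)) (conjᵢ-involutive q) ⟩
      scaled q 1ℚ *G scaled q (1ℚ ℚ.* s)                 ≡⟨ scaled-*G q q 1ℚ (1ℚ ℚ.* s) ⟩
      scaled (q ·ᵢ q) (1ℚ ℚ.* (1ℚ ℚ.* s))                ≡⟨ cong (scaled (q ·ᵢ q)) (trans (ℚP.*-identityˡ _) (ℚP.*-identityˡ s)) ⟩
      scaled (q ·ᵢ q) s                                  ∎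
  }
  where
  open ≡-Reasoning
  q = (+ m , + n)
  s = + 1 ℚ./ suc d
  normᵢq : normᵢ q ≡ + suc d
  normᵢq = trans (normᵢ-pos m n) (cong +_ m²+n²≡P)
  |q̄|²s≡1 : normG (scaled (conjᵢ q) 1ℚ) ℚ.* s ≡ 1ℚ
  |q̄|²s≡1 = begin
    normG (scaled (conjᵢ q) 1ℚ) ℚ.* s             ≡⟨ cong (ℚ._* s) (normG-scaled (conjᵢ q) 1ℚ) ⟩
    ι (normᵢ (conjᵢ q)) ℚ.* (1ℚ ℚ.* 1ℚ) ℚ.* s     ≡⟨ cong (λ x → ι x ℚ.* 1ℚ ℚ.* s) (trans (normᵢ-conjᵢ q) normᵢq) ⟩
    ι (+ suc d) ℚ.* 1ℚ ℚ.* s                      ≡⟨ cong (ℚ._* s) (ℚP.*-identityʳ (ι (+ suc d))) ⟩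
    ι (+ suc d) ℚ.* s                             ≡⟨ ι-inverse d ⟩
    1ℚ                                            ∎

zetaP-^ℤ : ∀ m n {P} ε e → m * m + n * n ≡ P → 0 < P →
  zetaP m n ^ℤ (ε ◃ e) ≡ (generator ε m n ·ᵢ generator ε m n) ^ᵢ e ÷ P ^ e
zetaP-^ℤ m n ε zero _ _ = 1≡1ᵢ÷1
zetaP-^ℤ m n {P} Sign.+ (suc e) m²+n²≡P 0<P =
  ÷-^G (suc e) (subst (λ q → zetaP m n ≡ q ·ᵢ q ÷ P) (cong (_, + n) (sym (ℤP.+◃n≡+n m))) (zetaP-÷ m n m²+n²≡P 0<P))
zetaP-^ℤ m n {P} Sign.- (suc e) m²+n²≡P 0<P =
  ÷-^G (suc e) (subst (λ w → invG (zetaP m n) ≡ w ÷ P) conj-square (÷-invG (zetaP-÷ m n m²+n²≡P 0<P)))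
  where
  conj-square : conjᵢ ((+ m , + n) ·ᵢ (+ m , + n)) ≡ generator Sign.- m n ·ᵢ generator Sign.- m n
  conj-square = trans (conjᵢ-square (+ m) (+ n)) (cong (λ x → (x , + n) ·ᵢ (x , + n)) (sym (ℤP.-◃n≡-n m)))

-- Reduction modulo a prime of ℤ[i] above p

euclidsLemmaℤ : ∀ {P} x y → Prime P → + P ∣ℤ x ℤ.* y → + P ∣ℤ x ⊎ + P ∣ℤ y
euclidsLemmaℤ {P} x y P-prime P∣xy = Sum.map ℤD.∣ᵤ⇒∣ ℤD.∣ᵤ⇒∣
  (euclidsLemma ℤ.∣ x ∣ ℤ.∣ y ∣ P-prime (subst (P ∣_) (ℤP.abs-* x y) (ℤD.∣⇒∣ᵤ P∣xy)))

∤⇒∤ℤ : ∀ {P x} → ¬ P ∣ x → ¬ + P ∣ℤ + x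
∤⇒∤ℤ P∤x = P∤x ∘ ℤD.∣⇒∣ᵤ

∤ℤ⇒∤ : ∀ {P x} → ¬ + P ∣ℤ x → ¬ P ∣ ℤ.∣ x ∣
∤ℤ⇒∤ P∤x = P∤x ∘ ℤD.∣ᵤ⇒∣

∣square⇒∣ : ∀ {P} x → Prime P → + P ∣ℤ x ℤ.* x → + P ∣ℤ x
∣square⇒∣ x P-prime P∣x² = Sum.reduce (euclidsLemmaℤ x x P-prime P∣x²)

-- For t² + n² = P, the map x + y i ↦ n x + t y is, up to the unit n, the reduction
-- ℤ[i] → ℤ[i] / (t − n i) ≅ 𝔽_P, so n · red (u ·ᵢ v) ≡ red u · red v (mod P).
module PrimeAbove {P : ℕ} (P-prime : Prime P) (n t : ℤ)
                  (t²+n²≡P : t ℤ.* t ℤ.+ n ℤ.* n ≡ + P) (P∤n : ¬ + P ∣ℤ n) where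

  red : ℤ[i] → ℤ
  red (x , y) = n ℤ.* x ℤ.+ t ℤ.* y

  infix 4 _∉𝔭
  _∉𝔭 : ℤ[i] → Set
  w ∉𝔭 = ¬ + P ∣ℤ red w

  P∣t²+n² : + P ∣ℤ t ℤ.* t ℤ.+ n ℤ.* n
  P∣t²+n² = subst (+ P ∣ℤ_) (sym t²+n²≡P) ℤD.∣-refl

  P∤t : ¬ + P ∣ℤ t
  P∤t P∣t = P∤n (∣square⇒∣ n P-prime (ℤD.∣m+n∣m⇒∣n P∣t²+n² (ℤD.∣m⇒∣m*n t P∣t)))

  1ᵢ∉𝔭 : 1ᵢ ∉𝔭
  1ᵢ∉𝔭 P∣red = P∤n (subst (+ P ∣ℤ_) (identity n t) P∣red)
    where
    identity : ∀ n t → n ℤ.* + 1 ℤ.+ t ℤ.* + 0 ≡ n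
    identity = ℤSolver.solve-∀

  ·ᵢ-∉𝔭 : ∀ {u v} → u ∉𝔭 → v ∉𝔭 → u ·ᵢ v ∉𝔭
  ·ᵢ-∉𝔭 {x , y} {x' , y'} u∉𝔭 v∉𝔭 P∣red =
    [ u∉𝔭 , v∉𝔭 ] (euclidsLemmaℤ (red (x , y)) (red (x' , y')) P-prime (subst (+ P ∣ℤ_) (sym (identity n t x y x' y'))
      (ℤD.∣m∣n⇒∣m+n (ℤD.∣n⇒∣m*n n P∣red) (ℤD.∣m⇒∣m*n (y ℤ.* y') P∣t²+n²))))
    where
    identity : ∀ n t x y x' y' →
      (n ℤ.* x ℤ.+ t ℤ.* y) ℤ.* (n ℤ.* x' ℤ.+ t ℤ.* y')
        ≡ n ℤ.* (n ℤ.* (x ℤ.* x' ℤ.- y ℤ.* y') ℤ.+ t ℤ.* (x ℤ.* y' ℤ.+ y ℤ.* x')) ℤ.+ (t ℤ.* t ℤ.+ n ℤ.* n) ℤ.* (y ℤ.* y')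
    identity = ℤSolver.solve-∀

  ^ᵢ-∉𝔭 : ∀ {w} e → w ∉𝔭 → w ^ᵢ e ∉𝔭
  ^ᵢ-∉𝔭 zero w∉𝔭 = 1ᵢ∉𝔭
  ^ᵢ-∉𝔭 (suc e) w∉𝔭 = ·ᵢ-∉𝔭 w∉𝔭 (^ᵢ-∉𝔭 e w∉𝔭)

  prodᵢ-∉𝔭 : ∀ k {w} → (∀ i → w i ∉𝔭) → prodᵢ k w ∉𝔭
  prodᵢ-∉𝔭 zero w∉𝔭 = 1ᵢ∉𝔭
  prodᵢ-∉𝔭 (suc k) w∉𝔭 = ·ᵢ-∉𝔭 (w∉𝔭 zero) (prodᵢ-∉𝔭 k (λ i → w∉𝔭 (suc i)))

  ∤normᵢ⇒∉𝔭 : ∀ w → ¬ + P ∣ℤ normᵢ w → w ∉𝔭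
  ∤normᵢ⇒∉𝔭 (x , y) P∤norm P∣red =
    [ (λ P∣n² → P∤n (∣square⇒∣ n P-prime P∣n²)) , P∤norm ] (euclidsLemmaℤ (n ℤ.* n) (normᵢ (x , y)) P-prime
      (subst (+ P ∣ℤ_) (identity n t x y)
        (ℤD.∣m∣n⇒∣m+n (ℤD.∣m⇒∣m*n (n ℤ.* x ℤ.- t ℤ.* y) P∣red) (ℤD.∣m⇒∣m*n (y ℤ.* y) P∣t²+n²))))
    where
    identity : ∀ n t x y →
      (n ℤ.* x ℤ.+ t ℤ.* y) ℤ.* (n ℤ.* x ℤ.- t ℤ.* y) ℤ.+ (t ℤ.* t ℤ.+ n ℤ.* n) ℤ.* (y ℤ.* y)
        ≡ (n ℤ.* n) ℤ.* (x ℤ.* x ℤ.+ y ℤ.* y)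
    identity = ℤSolver.solve-∀

  generator-∉𝔭 : ¬ + P ∣ℤ + 2 → (t , n) ∉𝔭
  generator-∉𝔭 P∤2 P∣red =
    [ [ P∤2 , P∤n ] ∘ euclidsLemmaℤ (+ 2) n P-prime , P∤t ]
      (euclidsLemmaℤ (+ 2 ℤ.* n) t P-prime (subst (+ P ∣ℤ_) (identity n t) P∣red))
    where
    identity : ∀ n t → n ℤ.* t ℤ.+ t ℤ.* n ≡ + 2 ℤ.* n ℤ.* t
    identity = ℤSolver.solve-∀

  ∉𝔭⇒∤components : ∀ {x y} → + P ∣ℤ normᵢ (x , y) → (x , y) ∉𝔭 → ¬ + P ∣ℤ x × ¬ + P ∣ℤ y
  ∉𝔭⇒∤components {x} {y} P∣norm w∉𝔭 =
    (λ P∣x → w∉𝔭 (P∣red P∣x (∣square⇒∣ y P-prime (ℤD.∣m+n∣m⇒∣n P∣norm (ℤD.∣m⇒∣m*n x P∣x))))) ,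
    (λ P∣y → w∉𝔭 (P∣red (∣square⇒∣ x P-prime (ℤD.∣m+n∣n⇒∣m P∣norm (ℤD.∣m⇒∣m*n y P∣y))) P∣y))
    where
    P∣red : + P ∣ℤ x → + P ∣ℤ y → + P ∣ℤ red (x , y)
    P∣red P∣x P∣y = ℤD.∣m∣n⇒∣m+n (ℤD.∣n⇒∣m*n n P∣x) (ℤD.∣n⇒∣m*n t P∣y)

-- Denominators of pythagorean triples

frac-scaled : ∀ {t c D s} Z → 0 < c → ι (+ D) ℚ.* s ≡ 1ℚ → frac t c ≡ ℚ.∣ ι Z ℚ.* s ∣ → t * D ≡ ℤ.∣ Z ∣ * c
frac-scaled {t} {suc c} {D} {s} Z _ Ds≡1 t/c≡∣Zs∣ = ℤP.+-injective (ι-injective (begin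
  ι (+ (t * D))                                   ≡⟨ ι-pos-* t D ⟩
  ι (+ t) ℚ.* ι (+ D)                             ≡⟨ cong (ℚ._* ι (+ D)) (sym (/-*-denominator (+ t) c)) ⟩
  frac t (suc c) ℚ.* C ℚ.* ι (+ D)                ≡⟨ cong (λ u → u ℚ.* C ℚ.* ι (+ D)) t/c≡∣Zs∣ ⟩
  ℚ.∣ ι Z ℚ.* s ∣ ℚ.* C ℚ.* ι (+ D)               ≡⟨ ℚ*.xy∙z≈xz∙y ℚ.∣ ι Z ℚ.* s ∣ C (ι (+ D)) ⟩
  ℚ.∣ ι Z ℚ.* s ∣ ℚ.* ι (+ D) ℚ.* C               ≡⟨ cong (λ u → ℚ.∣ ι Z ℚ.* s ∣ ℚ.* u ℚ.* C) (sym (∣ι∣ (+ D))) ⟩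
  ℚ.∣ ι Z ℚ.* s ∣ ℚ.* ℚ.∣ ι (+ D) ∣ ℚ.* C         ≡⟨ cong (ℚ._* C) (sym (ℚP.∣p*q∣≡∣p∣*∣q∣ (ι Z ℚ.* s) (ι (+ D)))) ⟩
  ℚ.∣ ι Z ℚ.* s ℚ.* ι (+ D) ∣ ℚ.* C               ≡⟨ cong (λ u → ℚ.∣ u ∣ ℚ.* C) Zs·D≡Z ⟩
  ℚ.∣ ι Z ∣ ℚ.* C                                 ≡⟨ cong (ℚ._* C) (∣ι∣ Z) ⟩
  ι (+ ℤ.∣ Z ∣) ℚ.* C                             ≡⟨ sym (ι-pos-* ℤ.∣ Z ∣ (suc c)) ⟩
  ι (+ (ℤ.∣ Z ∣ * suc c))                         ∎))
  where
  open ≡-Reasoning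
  C = ι (+ suc c)
  Zs·D≡Z : ι Z ℚ.* s ℚ.* ι (+ D) ≡ ι Z
  Zs·D≡Z = begin
    ι Z ℚ.* s ℚ.* ι (+ D)    ≡⟨ ℚ*.xy∙z≈x∙zy (ι Z) s (ι (+ D)) ⟩
    ι Z ℚ.* (ι (+ D) ℚ.* s)  ≡⟨ cong (ι Z ℚ.*_) Ds≡1 ⟩
    ι Z ℚ.* 1ℚ               ≡⟨ ℚP.*-identityʳ (ι Z) ⟩
    ι Z                      ∎

denominator-unique : ∀ {a b c N x y} → 0 < N → gcd (gcd a b) c ≡ 1 → Coprime N x →
  a * N ≡ x * c → b * N ≡ y * c → c ≡ N
denominator-unique {a} {b} {c} {N} {x} {y} 0<N gcd≡1 N⊥x aN≡xc bN≡yc = begin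
  c      ≡⟨ c≡rN ⟩
  r * N  ≡⟨ cong (_* N) r≡1 ⟩
  1 * N  ≡⟨ ℕP.*-identityˡ N ⟩
  N      ∎
  where
  open ≡-Reasoning
  instance _ = >-nonZero 0<N
  N∣c : N ∣ c
  N∣c = coprime-divisor N⊥x (divides a (sym aN≡xc))
  r = quotient N∣c
  c≡rN : c ≡ r * N
  c≡rN = m∣n⇒n≡quotient*m N∣c
  r∣numerator : ∀ t z → t * N ≡ z * c → r ∣ t
  r∣numerator t z tN≡zc = divides z (ℕP.*-cancelʳ-≡ t (z * r) N
    (trans tN≡zc (trans (cong (z *_) c≡rN) (sym (ℕP.*-assoc z r N)))))
  r≡1 : r ≡ 1
  r≡1 = ∣1⇒≡1 (subst (r ∣_) gcd≡1 (gcd-greatest (gcd-greatest (r∣numerator a x aN≡xc) (r∣numerator b y bN≡yc))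
    (divides N (trans c≡rN (ℕP.*-comm r N)))))

pt-denominator : ∀ {z X Y N a b c} → z ≡ (X , Y) ÷ N → 0 < N →
  Coprime N ℤ.∣ X ∣ → Coprime N ℤ.∣ Y ∣ → IsPt z a b c → c ≡ N
pt-denominator {X = X} {Y} {N} {a} {b} {c} z÷ 0<N N⊥X N⊥Y pt =
  pt-of-scaled (subst (λ u → IsPt u a b c) (z≡w*D⁻¹ z÷) pt)
  where
  open _≡_÷_
  s = D⁻¹ z÷
  numerator : ∀ {t u} → 0 < c → frac t c ≡ u → u ≡ ℚ.∣ ι X ℚ.* s ∣ ⊎ u ≡ ℚ.∣ ι Y ℚ.* s ∣ →
    Σ ℕ λ x → Coprime N x × t * N ≡ x * c
  numerator 0<c t/c≡u (inj₁ u≡) = ℤ.∣ X ∣ , N⊥X , frac-scaled X 0<c (D*D⁻¹≡1 z÷) (trans t/c≡u u≡)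
  numerator 0<c t/c≡u (inj₂ u≡) = ℤ.∣ Y ∣ , N⊥Y , frac-scaled Y 0<c (D*D⁻¹≡1 z÷) (trans t/c≡u u≡)
  pt-of-scaled : IsPt (scaled (X , Y) s) a b c → c ≡ N
  pt-of-scaled ((_ , _ , 0<c , _ , gcd≡1 , _) , a/c≡min , b/c≡max)
    with numerator 0<c a/c≡min (ℚP.⊓-sel _ _) | numerator 0<c b/c≡max (ℚP.⊔-sel _ _)
  ... | x , N⊥x , aN≡xc | y , _ , bN≡yc = denominator-unique {a} {b} {y = y} 0<N gcd≡1 N⊥x aN≡xc bN≡yc

prime∤⇒coprime : ∀ {P z} → Prime P → ¬ P ∣ z → Coprime P z
prime∤⇒coprime P-prime P∤z (d∣P , d∣z) with prime⇒irreducible P-prime d∣P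
... | inj₁ d≡1 = d≡1
... | inj₂ refl = ⊥-elim (P∤z d∣z)

coprime-* : ∀ {a b z} → Coprime a z → Coprime b z → Coprime (a * b) z
coprime-* {a} {b} {z} a⊥z b⊥z {d} (d∣ab , d∣z) = b⊥z (coprime-divisor d⊥a d∣ab , d∣z)
  where
  d⊥a : Coprime d a
  d⊥a (e∣d , e∣a) = a⊥z (e∣a , ∣-trans e∣d d∣z)

coprime-^ : ∀ {a z} → Coprime a z → ∀ e → Coprime (a ^ e) z
coprime-^ a⊥z zero (d∣1 , _) = ∣1⇒≡1 d∣1
coprime-^ a⊥z (suc e) = coprime-* a⊥z (coprime-^ a⊥z e)

coprime-prodℕ : ∀ k {f z} → (∀ i → Coprime (f i) z) → Coprime (prodℕ k f) z
coprime-prodℕ zero _ (d∣1 , _) = ∣1⇒≡1 d∣1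
coprime-prodℕ (suc k) f⊥z = coprime-* (f⊥z zero) (coprime-prodℕ k (λ i → f⊥z (suc i)))

m*n>0 : ∀ {m n} → 0 < m → 0 < n → 0 < m * n
m*n>0 {suc m} {suc n} _ _ = s≤s z≤n

∣-prodℕ : ∀ k f i → f i ∣ prodℕ k f
∣-prodℕ (suc k) f zero = m∣m*n (prodℕ k (λ i → f (suc i)))
∣-prodℕ (suc k) f (suc i) = ∣n⇒∣m*n (f zero) (∣-prodℕ k (λ j → f (suc j)) i)

prodℕ-pos : ∀ k {f} → (∀ i → 0 < f i) → 0 < prodℕ k f
prodℕ-pos zero _ = s≤s z≤n
prodℕ-pos (suc k) 0<f = m*n>0 (0<f zero) (prodℕ-pos k (λ i → 0<f (suc i)))

∣^ : ∀ P {e} → 0 < e → P ∣ P ^ e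
∣^ P {suc e} _ = m∣m*n (P ^ e)

prime∤prime : ∀ {P Q} → Prime P → Prime Q → P ≢ Q → ¬ P ∣ Q
prime∤prime P-prime Q-prime P≢Q P∣Q =
  [ (λ P≡1 → ¬prime[1] (subst Prime P≡1 P-prime)) , P≢Q ] (prime⇒irreducible Q-prime P∣Q)

≡1-mod-4⇒∤2 : ∀ {P} → Prime P → P % 4 ≡ 1 → ¬ P ∣ 2
≡1-mod-4⇒∤2 {0} P-prime _ _ = ¬prime[0] P-prime
≡1-mod-4⇒∤2 {1} P-prime _ _ = ¬prime[1] P-prime
≡1-mod-4⇒∤2 {2} _ () _
≡1-mod-4⇒∤2 {suc (suc (suc _))} _ _ = >⇒∤ (s≤s (s≤s (s≤s z≤n)))

n<m²+n² : ∀ {m n} → 0 < m → 0 < n → n < m * m + n * n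
n<m²+n² {m} {n} 0<m 0<n = ℕP.≤-<-trans (ℕP.m≤m*n n n) (ℕP.m<n+m (n * n) (m*n>0 0<m 0<m))
  where instance _ = >-nonZero 0<n

lemma5p1 : (k : ℕ) → 0 < k →
  (p : Fin k → ℕ) → Injective _≡_ _≡_ p →
  (∀ i → Prime (p i)) → (∀ i → p i % 4 ≡ 1) →
  (m n : Fin k → ℕ) →
  (∀ i → 0 < m i) → (∀ i → m i < n i) →
  (∀ i → m i * m i + n i * n i ≡ p i) →
  (e : Fin k → ℕ) → (∀ i → 0 < e i) →
  (ε : Fin k → Sign) →
  (a b c : ℕ) →
  IsPt (prodG k (λ i → zetaP (m i) (n i) ^ℤ (ε i ◃ e i))) a b c →
  c ≡ prodℕ k (λ i → p i ^ e i)
lemma5p1 k _ p p-injective p-prime p≡1mod4 m n 0<m m<n m²+n²≡p e 0<e ε a b c pt =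
  pt-denominator ζ≡W÷N 0<N (N⊥ (proj₁ ∘ p∤components)) (N⊥ (proj₂ ∘ p∤components)) pt
  where
  q : Fin k → ℤ[i]
  q i = generator (ε i) (m i) (n i)
  W : ℤ[i]
  W = prodᵢ k (λ i → (q i ·ᵢ q i) ^ᵢ e i)
  N : ℕ
  N = prodℕ k (λ i → p i ^ e i)
  0<n : ∀ i → 0 < n i
  0<n i = ℕP.<-trans (0<m i) (m<n i)
  0<p : ∀ i → 0 < p i
  0<p i = subst (0 <_) (m²+n²≡p i) (ℕP.<-trans (0<n i) (n<m²+n² (0<m i) (0<n i)))
  0<N : 0 < N
  0<N = prodℕ-pos k (λ i → ℕP.m^n>0 (p i) {{>-nonZero (0<p i)}} (e i))
  ζ≡W÷N : prodG k (λ i → zetaP (m i) (n i) ^ℤ (ε i ◃ e i)) ≡ W ÷ N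
  ζ≡W÷N = ÷-prodG k (λ i → zetaP-^ℤ (m i) (n i) (ε i) (e i) (m²+n²≡p i) (0<p i))
  normᵢq : ∀ i → normᵢ (q i) ≡ + p i
  normᵢq i = trans (normᵢ-generator (ε i) (m i) (n i)) (cong +_ (m²+n²≡p i))
  p∤n : ∀ j → ¬ p j ∣ n j
  p∤n j = >⇒∤ {{>-nonZero (0<n j)}} (subst (n j <_) (m²+n²≡p j) (n<m²+n² (0<m j) (0<n j)))
  module 𝔭 (j : Fin k) = PrimeAbove (p-prime j) (+ n j) (ε j ◃ m j) (normᵢq j) (∤⇒∤ℤ (p∤n j))
  q∉𝔭 : ∀ j i → 𝔭._∉𝔭 j (q i)
  q∉𝔭 j i = case i Fin.≟ j of λ where
    (yes refl) → 𝔭.generator-∉𝔭 j (∤⇒∤ℤ (≡1-mod-4⇒∤2 (p-prime j) (p≡1mod4 j)))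
    (no i≢j) → 𝔭.∤normᵢ⇒∉𝔭 j (q i) (subst (λ x → ¬ + p j ∣ℤ x) (sym (normᵢq i))
      (∤⇒∤ℤ (prime∤prime (p-prime j) (p-prime i) (i≢j ∘ p-injective ∘ sym))))
  p∣N : ∀ j → p j ∣ N
  p∣N j = ∣-trans (∣^ (p j) (0<e j)) (∣-prodℕ k (λ i → p i ^ e i) j)
  p∤components : ∀ j → ¬ + p j ∣ℤ proj₁ W × ¬ + p j ∣ℤ proj₂ W
  p∤components j = 𝔭.∉𝔭⇒∤components j {proj₁ W} {proj₂ W}
    (subst (+ p j ∣ℤ_) (sym (_≡_÷_.normᵢ≡D² ζ≡W÷N)) (ℤD.∣m⇒∣m*n (+ N) (ℤD.∣ᵤ⇒∣ {+ p j} {+ N} (p∣N j))))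
    (𝔭.prodᵢ-∉𝔭 j k (λ i → 𝔭.^ᵢ-∉𝔭 j (e i) (𝔭.·ᵢ-∉𝔭 j (q∉𝔭 j i) (q∉𝔭 j i))))
  N⊥ : ∀ {x} → (∀ j → ¬ + p j ∣ℤ x) → Coprime N ℤ.∣ x ∣
  N⊥ p∤x = coprime-prodℕ k (λ j → coprime-^ (prime∤⇒coprime (p-prime j) (∤ℤ⇒∤ (p∤x j))) (e j))
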